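{- For a subpermutation $s$ of length $n$ and any $i, j \in \{0,\dots,n\}$, we have $M^s_{i,j}=\mathsf{LIS}(s[i..j))$ if $i<j$, and $M^s_{i,j}=-2(i-j)$ if $i\ge j$. Furthermore, every longest path in $G^s$ from $(i,0)$ to $(j,|s^*|)$ is monotone in both coordinates.
   Context: A sequence $s[0],\dots,s[n-1]$ is a subpermutation if each $s[i]\in\{0,\dots,n-1\}\cup\{\star\}$ (where $\star$ is a placeholder symbol) and the subsequence $s^*$ of non-placeholder elements is a permutation of $\{0,\dots,|s^*|-1\}$. For $0\le i<j\le n$, $s[i..j)$ is $s[i],\dots,s[j-1]$ and $\mathsf{LIS}(s[i..j))$ is the maximum length of a (not necessarily contiguous) strictly increasing subsequence of $s[i..j)$ containing no $\star$. The alignment graph $G^s$ is the edge-weighted directed graph with vertex set $\{0,\dots,n\}\times\{0,\dots,|s^*|\}$ and edges: $(x,y)\to(x,y+1)$ of weight $0$ for $y<|s^*|$; $(x,y)\to(x+1,y)$ of weight $0$ for $x<n$; $(i,s[i])\to(i+1,s[i]+1)$ of weight $1$ for each $i$ with $s[i]\ne\star$; and $(x,y)\to(x-1,y)$ of weight $-2$ for $x>0$. $M^s$ is the $(n+1)\times(n+1)$ matrix with $M^s_{i,j}$ equal to the length of the longest path in $G^s$ from $(i,0)$ to $(j,|s^*|)$ (well defined since $G^s$ has no cycles of nonnegative length). -}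

module Defs where

open import Data.Nat using (ℕ; zero; suc; _≤_; _<_; _<?_; _⊔_; _*_; _∸_)
open import Data.Integer as ℤ using (ℤ; +_; -_)
open import Data.Fin using (Fin; toℕ)
open import Data.Maybe using (Maybe; just; nothing)
open import Data.Vec using (Vec; lookup; toList)
open import Data.List using (List; []; _∷_; length; catMaybes; upTo; map; filter; foldr; take; drop; _++_)
open import Data.List.Relation.Unary.All using (All)
open import Data.List.Relation.Unary.Linked using (Linked; linked?)
open import Data.List.Relation.Binary.Permutation.Propositional using (_↭_)
open import Data.Product using (Σ; _×_; _,_)
open import Data.Sum using (_⊎_)
open import Data.Unit using (⊤)
open import Relation.Binary.PropositionalEquality using (_≡_)

-- A sequence of length n over {0,..,n-1} ∪ {⋆}; ⋆ is represented by 'nothing'.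
Seq : ℕ → Set
Seq n = Vec (Maybe ℕ) n

star : ∀ {n} → Seq n → List ℕ
star s = catMaybes (toList s)

m∣ : ∀ {n} → Seq n → ℕ
m∣ s = length (star s)

InRange : ℕ → Maybe ℕ → Set
InRange n nothing  = ⊤
InRange n (just v) = v < n

IsSubpermutation : ∀ {n} → Seq n → Set
IsSubpermutation {n} s = All (InRange n) (toList s) × (star s ↭ upTo (m∣ s))

segment : ∀ {n} → Seq n → ℕ → ℕ → List (Maybe ℕ)
segment s i j = take (j ∸ i) (drop i (toList s))

sublists : {A : Set} → List A → List (List A)
sublists []       = [] ∷ []
sublists (x ∷ xs) = let r = sublists xs in map (x ∷_) r ++ r

maximum : List ℕ → ℕ
maximum = foldr _⊔_ 0

-- LIS(xs): maximum length of a strictly increasing subsequence of xs containing no ⋆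
-- (subsequences avoiding ⋆ are exactly the subsequences of the non-⋆ entries)
LIS : List (Maybe ℕ) → ℕ
LIS xs = maximum (map length (filter (linked? _<?_) (sublists (catMaybes xs))))

V : Set
V = ℕ × ℕ

data Edge {n : ℕ} (s : Seq n) : V → V → ℤ → Set where
  up    : ∀ {x y} → x ≤ n → y < m∣ s → Edge s (x , y) (x , suc y) (+ 0)
  right : ∀ {x y} → x < n → y ≤ m∣ s → Edge s (x , y) (suc x , y) (+ 0)
  diag  : ∀ (i : Fin n) {v} → lookup s i ≡ just v →
          Edge s (toℕ i , v) (suc (toℕ i) , suc v) (+ 1)
  left  : ∀ {x y} → suc x ≤ n → y ≤ m∣ s → Edge s (suc x , y) (x , y) (- (+ 2))

data Path {n : ℕ} (s : Seq n) : V → V → ℤ → Set where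
  []  : ∀ {u} → Path s u u (+ 0)
  _∷_ : ∀ {u v w a b} → Edge s u v a → Path s v w b → Path s u w (a ℤ.+ b)

vertices : ∀ {n} {s : Seq n} {u v a} → Path s u v a → List V
vertices {u = u} []      = u ∷ []
vertices {u = u} (e ∷ p) = u ∷ vertices p

xcoords ycoords : List V → List ℕ
xcoords = map (λ { (x , y) → x })
ycoords = map (λ { (x , y) → y })

_≥_ : ℕ → ℕ → Set
a ≥ b = b ≤ a

MonotoneList : List ℕ → Set
MonotoneList zs = Linked _≤_ zs ⊎ Linked _≥_ zs

Monotone : ∀ {n} {s : Seq n} {u v a} → Path s u v a → Set
Monotone p = MonotoneList (xcoords (vertices p)) × MonotoneList (ycoords (vertices p))

IsLongest : ∀ {n} {s : Seq n} {u v a} → Path s u v a → Set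
IsLongest {s = s} {u} {v} {a} p = ∀ {b} → Path s u v b → b ℤ.≤ a

M≡ : ∀ {n} → Seq n → ℕ → ℕ → ℤ → Set
M≡ s i j w = Σ (Path s (i , 0) (j , m∣ s) w) IsLongest

{-# OPTIONS --safe #-}
-- A path in G^s from column i to column j has weight #diagonal ⊖ 2·#leftward, and
-- #rightward − #leftward = j − i, where diagonal edges count as rightward moves.
--
-- For i ≤ j, the longest increasing subsequence of s[x..j) with entries ≥ y is a
-- potential on vertices (x , y): it does not increase along up and right edges, drops
-- by at least one along a diagonal edge before column j, and rises by at most one along
-- a leftward edge.  A diagonal edge beyond column j has to be paid back by a leftward
-- edge, which the excess x ∸ j accounts for.  Telescoping gives
-- #diagonal ≤ #leftward + LIS(s[i..j)), so every path has weight at most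
-- LIS(s[i..j)) − #leftward, and the dynamic program computing that LIS traces a path
-- attaining it.
--
-- For i ≥ j, #leftward = #rightward + (i − j) and #diagonal ≤ #rightward bound the
-- weight by −2(i − j) − #rightward, attained by going up and then left.
--
-- So a longest path has no leftward (respectively, no rightward) edges, and is
-- therefore monotone in both coordinates.

module Submission where

open import Defs
open import Data.Nat using (ℕ; zero; suc; _+_; _*_; _∸_; _⊔_; _≤_; _<_; _≤?_; _<?_; z≤n; s≤s; _≤‴_; ≤‴-refl; ≤‴-step)
open import Data.Nat.Properties
open import Data.Nat.Tactic.RingSolver using (solve-∀)
open import Data.Integer using (ℤ; +_; -_; _⊖_) renaming (_+_ to _+ℤ_; _≤_ to _≤ℤ_)
import Data.Integer.Properties as ℤP
open import Data.Fin as Fin using (Fin; toℕ; fromℕ<)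
open import Data.Fin.Properties using (toℕ-fromℕ<)
open import Data.Vec using (_∷_; lookup; toList)
open import Data.Vec.Membership.Propositional using () renaming (_∈_ to _∈ᵥ_)
open import Data.Vec.Membership.Propositional.Properties using (∈-lookup; ∈-toList⁺)
open import Data.Maybe using (Maybe; just; nothing)
open import Data.List using (List; []; _∷_; length; catMaybes; map; take; drop)
open import Data.List.Properties using (foldr-preservesᵇ; foldr-preservesᵒ)
open import Data.List.Membership.Propositional using (_∈_)
open import Data.List.Membership.Propositional.Properties using (∈-++⁻; ∈-++⁺ˡ; ∈-++⁺ʳ; ∈-map⁺; ∈-map⁻; ∈-map∘filter⁺; ∈-map∘filter⁻; ∈-upTo⁻)
open import Data.List.Relation.Unary.Any as Any using (here; there)
open import Data.List.Relation.Unary.All as All using (All; []; _∷_)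
open import Data.List.Relation.Unary.Linked as Linked using (Linked; []; [-]; _∷_; linked?)
import Data.List.Relation.Unary.Linked.Properties as Linkedₚ
open import Data.List.Relation.Binary.Permutation.Propositional.Properties using (∈-resp-↭)
open import Data.Product using (∃-syntax; _×_; _,_; proj₁; proj₂; map₁)
open import Data.Sum using (inj₁; inj₂; [_,_])
open import Function using (_∘_)
open import Relation.Nullary using (yes; no; contradiction)
open import Relation.Binary.PropositionalEquality using (_≡_; refl; sym; trans; cong; cong₂; subst; subst₂; module ≡-Reasoning)

m+q≤p+n⇒m⊖n≤p⊖q : ∀ m n p q → m + q ≤ p + n → m ⊖ n ≤ℤ p ⊖ q
m+q≤p+n⇒m⊖n≤p⊖q m n p q le = begin
  m ⊖ n              ≡⟨ ℤP.+-cancelˡ-⊖ q m n ⟨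
  (q + m) ⊖ (q + n)  ≤⟨ ℤP.⊖-monoˡ-≤ (q + n) (subst₂ _≤_ (+-comm m q) (+-comm p n) le) ⟩
  (n + p) ⊖ (q + n)  ≡⟨ cong ((n + p) ⊖_) (+-comm q n) ⟩
  (n + p) ⊖ (n + q)  ≡⟨ ℤP.+-cancelˡ-⊖ n p q ⟩
  p ⊖ q              ∎
  where open ℤP.≤-Reasoning

m⊖n≤p⊖q⇒m+q≤p+n : ∀ m n p q → m ⊖ n ≤ℤ p ⊖ q → m + q ≤ p + n
m⊖n≤p⊖q⇒m+q≤p+n m n p q le with m + q ≤? p + n
... | yes m+q≤p+n = m+q≤p+n
... | no  m+q≰p+n = contradiction (ℤP.≤-trans (m+q≤p+n⇒m⊖n≤p⊖q (suc p) q m n (≰⇒> m+q≰p+n)) le)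
                                  (ℤP.<⇒≱ (ℤP.⊖-monoˡ-< q (n<1+n p)))

m+n≤m⇒n≡0 : ∀ {m n} → m + n ≤ m → n ≡ 0
m+n≤m⇒n≡0 {m} {n} le = n≤0⇒n≡0 (+-cancelˡ-≤ m n 0 (subst (m + n ≤_) (sym (+-identityʳ m)) le))

∈-catMaybes⁺ : ∀ {A : Set} {v : A} {xs} → just v ∈ xs → v ∈ catMaybes xs
∈-catMaybes⁺ {xs = just _ ∷ _}  (here refl) = here refl
∈-catMaybes⁺ {xs = just _ ∷ _}  (there v∈)  = there (∈-catMaybes⁺ v∈)
∈-catMaybes⁺ {xs = nothing ∷ _} (there v∈)  = ∈-catMaybes⁺ v∈

lis≥ : ℕ → List (Maybe ℕ) → ℕ
lis≥ y []             = 0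
lis≥ y (nothing ∷ xs) = lis≥ y xs
lis≥ y (just v ∷ xs) with y ≤? v
... | yes _ = suc (lis≥ (suc v) xs) ⊔ lis≥ y xs
... | no  _ = lis≥ y xs

lis≥-antitone : ∀ {y y′} → y ≤ y′ → ∀ xs → lis≥ y′ xs ≤ lis≥ y xs
lis≥-antitone y≤y′ []             = z≤n
lis≥-antitone y≤y′ (nothing ∷ xs) = lis≥-antitone y≤y′ xs
lis≥-antitone {y} {y′} y≤y′ (just v ∷ xs) with y′ ≤? v | y ≤? v
... | yes _    | yes _   = ⊔-monoʳ-≤ _ (lis≥-antitone y≤y′ xs)
... | yes y′≤v | no y≰v  = contradiction (≤-trans y≤y′ y′≤v) y≰v
... | no _     | yes _   = m≤n⇒m≤o⊔n _ (lis≥-antitone y≤y′ xs)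
... | no _     | no _    = lis≥-antitone y≤y′ xs

lis≥-skip : ∀ y a xs → lis≥ y xs ≤ lis≥ y (a ∷ xs)
lis≥-skip y nothing  xs = ≤-refl
lis≥-skip y (just v) xs with y ≤? v
... | yes _ = m≤n⊔m _ _
... | no  _ = ≤-refl

lis≥-take : ∀ {y v} xs → y ≤ v → suc (lis≥ (suc v) xs) ≤ lis≥ y (just v ∷ xs)
lis≥-take {y} {v} xs y≤v with y ≤? v
... | yes _   = m≤m⊔n _ (lis≥ y xs)
... | no y≰v = contradiction y≤v y≰v

lis≥-∷≤ : ∀ y a xs → lis≥ y (a ∷ xs) ≤ suc (lis≥ y xs)
lis≥-∷≤ y nothing  xs = n≤1+n _
lis≥-∷≤ y (just v) xs with y ≤? v
... | yes y≤v = ⊔-lub (s≤s (lis≥-antitone (m≤n⇒m≤1+n y≤v) xs)) (n≤1+n _)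
... | no  _   = n≤1+n _

Increasing≥ : ℕ → List ℕ → Set
Increasing≥ y zs = Linked _<_ zs × All (y ≤_) zs

increasing≥-∷⁻ : ∀ {y v zs} → Increasing≥ y (v ∷ zs) → y ≤ v × Increasing≥ (suc v) zs
increasing≥-∷⁻ {zs = []}    (_ , y≤v ∷ _) = y≤v , [] , []
increasing≥-∷⁻ {zs = _ ∷ _} (v<z ∷ inc , y≤v ∷ _) = y≤v , inc , Linkedₚ.Linked⇒All <-trans v<z inc

increasing≥-∷⁺ : ∀ {y v zs} → y ≤ v → Increasing≥ (suc v) zs → Increasing≥ y (v ∷ zs)
increasing≥-∷⁺ y≤v ([] , [])          = [-] , y≤v ∷ []
increasing≥-∷⁺ y≤v (inc , v<z ∷ above) =
  v<z ∷ inc , y≤v ∷ All.map (λ v<z′ → ≤-trans y≤v (<⇒≤ v<z′)) (v<z ∷ above)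

IncreasingSublist≥ : ℕ → List (Maybe ℕ) → ℕ → Set
IncreasingSublist≥ y xs ℓ = ∃[ zs ] zs ∈ sublists (catMaybes xs) × Increasing≥ y zs × length zs ≡ ℓ

lis≥-upper : ∀ {y ℓ} xs → IncreasingSublist≥ y xs ℓ → ℓ ≤ lis≥ y xs
lis≥-upper [] (_ , here refl , _ , refl) = z≤n
lis≥-upper (nothing ∷ xs) inc = lis≥-upper xs inc
lis≥-upper {y} (just v ∷ xs) (zs , zs∈ , asc , refl) with ∈-++⁻ (map (v ∷_) (sublists (catMaybes xs))) zs∈
... | inj₂ zs∈′ = ≤-trans (lis≥-upper xs (zs , zs∈′ , asc , refl)) (lis≥-skip y (just v) xs)
... | inj₁ v∷∈ with ∈-map⁻ (v ∷_) v∷∈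
...   | ws , ws∈ , refl with increasing≥-∷⁻ asc
...     | y≤v , asc′ = ≤-trans (s≤s (lis≥-upper xs (ws , ws∈ , asc′ , refl))) (lis≥-take xs y≤v)

sublist-skip : ∀ {y ℓ} a xs → IncreasingSublist≥ y xs ℓ → IncreasingSublist≥ y (a ∷ xs) ℓ
sublist-skip nothing  xs inc                    = inc
sublist-skip (just v) xs (zs , zs∈ , asc , len) = zs , ∈-++⁺ʳ _ zs∈ , asc , len

sublist-take : ∀ {y v ℓ} xs → y ≤ v → IncreasingSublist≥ (suc v) xs ℓ →
               IncreasingSublist≥ y (just v ∷ xs) (suc ℓ)
sublist-take {v = v} xs y≤v (zs , zs∈ , asc , len) =
  v ∷ zs , ∈-++⁺ˡ (∈-map⁺ _ zs∈) , increasing≥-∷⁺ y≤v asc , cong suc len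

lis≥-attained : ∀ y xs → IncreasingSublist≥ y xs (lis≥ y xs)
lis≥-attained y []             = [] , here refl , ([] , []) , refl
lis≥-attained y (nothing ∷ xs) = lis≥-attained y xs
lis≥-attained y (just v ∷ xs) with y ≤? v
... | no _    = sublist-skip (just v) xs (lis≥-attained y xs)
... | yes y≤v with ⊔-sel (suc (lis≥ (suc v) xs)) (lis≥ y xs)
...   | inj₁ ⊔≡take = subst (IncreasingSublist≥ y (just v ∷ xs)) (sym ⊔≡take)
                             (sublist-take xs y≤v (lis≥-attained (suc v) xs))
...   | inj₂ ⊔≡skip = subst (IncreasingSublist≥ y (just v ∷ xs)) (sym ⊔≡skip)
                             (sublist-skip (just v) xs (lis≥-attained y xs))

LIS≡lis≥0 : ∀ xs → LIS xs ≡ lis≥ 0 xs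
LIS≡lis≥0 xs = ≤-antisym
  (foldr-preservesᵇ {P = _≤ lis≥ 0 xs} ⊔-lub z≤n
    (All.tabulate (bounded ∘ ∈-map∘filter⁻ length (linked? _<?_))))
  (foldr-preservesᵒ {P = lis≥ 0 xs ≤_} (λ a b → [ m≤n⇒m≤n⊔o b , m≤n⇒m≤o⊔n a ]) 0 _
    (inj₂ (Any.map ≤-reflexive (∈-map∘filter⁺ length (linked? _<?_) witness))))
  where
  bounded : ∀ {ℓ} → ∃[ zs ] zs ∈ sublists (catMaybes xs) × ℓ ≡ length zs × Linked _<_ zs → ℓ ≤ lis≥ 0 xs
  bounded (zs , zs∈ , refl , inc) = lis≥-upper xs (zs , zs∈ , (inc , All.universal (λ _ → z≤n) zs) , refl)
  witness : ∃[ zs ] zs ∈ sublists (catMaybes xs) × lis≥ 0 xs ≡ length zs × Linked _<_ zs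
  witness with lis≥-attained 0 xs
  ... | zs , zs∈ , (inc , _) , len = zs , zs∈ , sym len , inc

module _ {n} {s : Seq n} where

  EdgeCount : Set
  EdgeCount = ∀ {u v w} → Edge s u v w → ℕ

  count : EdgeCount → ∀ {u v w} → Path s u v w → ℕ
  count c []      = 0
  count c (e ∷ p) = c e + count c p

  isDiagonal isLeftward isRightward : EdgeCount
  isDiagonal (diag _ _) = 1
  isDiagonal _          = 0
  isLeftward (left _ _) = 1
  isLeftward _          = 0
  isRightward (right _ _) = 1
  isRightward (diag _ _)  = 1
  isRightward _           = 0

  weight≡ : ∀ {u v w} (p : Path s u v w) → w ≡ count isDiagonal p ⊖ 2 * count isLeftward p
  weight≡ []              = refl
  weight≡ (up _ _ ∷ p)    = trans (ℤP.+-identityˡ _) (weight≡ p)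
  weight≡ (right _ _ ∷ p) = trans (ℤP.+-identityˡ _) (weight≡ p)
  weight≡ (diag _ _ ∷ p)  =
    trans (cong (+ 1 +ℤ_) (weight≡ p)) (ℤP.distribʳ-⊖-+-pos 1 (count isDiagonal p) (2 * count isLeftward p))
  weight≡ (_∷_ {b = w} (left _ _) p) = begin
    - + 2 +ℤ w                   ≡⟨ cong (- + 2 +ℤ_) (weight≡ p) ⟩
    - + 2 +ℤ (D ⊖ 2 * L)         ≡⟨ ℤP.distribʳ-⊖-+-neg 1 D (2 * L) ⟩
    D ⊖ (2 + 2 * L)              ≡⟨ cong (D ⊖_) (*-suc 2 L) ⟨
    D ⊖ 2 * suc L                ∎
    where
    open ≡-Reasoning
    D = count isDiagonal p
    L = count isLeftward p

  rightward+x≡leftward+x′ : ∀ {x y x′ y′ w} (p : Path s (x , y) (x′ , y′) w) →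
                            count isRightward p + x ≡ count isLeftward p + x′
  rightward+x≡leftward+x′ []                       = refl
  rightward+x≡leftward+x′ (up _ _ ∷ p)             = rightward+x≡leftward+x′ p
  rightward+x≡leftward+x′ {x} (right _ _ ∷ p)      = trans (sym (+-suc _ x)) (rightward+x≡leftward+x′ p)
  rightward+x≡leftward+x′ (diag k _ ∷ p)           = trans (sym (+-suc _ (toℕ k))) (rightward+x≡leftward+x′ p)
  rightward+x≡leftward+x′ {suc x} (left _ _ ∷ p)   = trans (+-suc _ x) (cong suc (rightward+x≡leftward+x′ p))

  diagonal≤rightward : ∀ {u v w} (p : Path s u v w) → count isDiagonal p ≤ count isRightward p
  diagonal≤rightward []              = z≤n
  diagonal≤rightward (up _ _ ∷ p)    = diagonal≤rightward p
  diagonal≤rightward (right _ _ ∷ p) = m≤n⇒m≤1+n (diagonal≤rightward p)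
  diagonal≤rightward (diag _ _ ∷ p)  = s≤s (diagonal≤rightward p)
  diagonal≤rightward (left _ _ ∷ p)  = diagonal≤rightward p

  leftward≡rightward+∸ : ∀ {x y x′ y′ w} → x′ ≤ x → (p : Path s (x , y) (x′ , y′) w) →
                         count isLeftward p ≡ count isRightward p + (x ∸ x′)
  leftward≡rightward+∸ {x} {x′ = x′} x′≤x p = +-cancelʳ-≡ x′ L (R + (x ∸ x′)) (begin
    L + x′             ≡⟨ rightward+x≡leftward+x′ p ⟨
    R + x              ≡⟨ cong (λ t → R + t) (m∸n+n≡m x′≤x) ⟨
    R + (x ∸ x′ + x′)  ≡⟨ +-assoc R (x ∸ x′) x′ ⟨
    R + (x ∸ x′) + x′  ∎)
    where
    open ≡-Reasoning
    L = count isLeftward p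
    R = count isRightward p

  telescope : (c d : EdgeCount) (a b : V → ℕ) →
              (∀ {u v w} (e : Edge s u v w) → c e + a u + b v ≤ d e + a v + b u) →
              ∀ {u v w} (p : Path s u v w) → count c p + a u + b v ≤ count d p + a v + b u
  telescope c d a b step []                                  = ≤-refl
  telescope c d a b step {u} (_∷_ {v = v} {w = w} e p) = +-cancelʳ-≤ (a v + b v) _ _ (begin
    count c (e ∷ p) + a u + b w + (a v + b v)      ≡⟨ regroupˡ (c e) (count c p) (a u) (b v) (a v) (b w) ⟩
    (c e + a u + b v) + (count c p + a v + b w)    ≤⟨ +-mono-≤ (step e) (telescope c d a b step p) ⟩
    (d e + a v + b u) + (count d p + a w + b v)    ≡⟨ regroupʳ (d e) (count d p) (a v) (b u) (a w) (b v) ⟩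
    count d (e ∷ p) + a w + b u + (a v + b v)      ∎)
    where
    open ≤-Reasoning
    regroupˡ : ∀ c₁ c₂ a₁ b₂ a₂ b₃ → c₁ + c₂ + a₁ + b₃ + (a₂ + b₂) ≡ (c₁ + a₁ + b₂) + (c₂ + a₂ + b₃)
    regroupˡ = solve-∀
    regroupʳ : ∀ d₁ d₂ a₂ b₁ a₃ b₂ → (d₁ + a₂ + b₁) + (d₂ + a₃ + b₂) ≡ d₁ + d₂ + a₃ + b₁ + (a₂ + b₂)
    regroupʳ = solve-∀

  vertices-linked : ∀ {R : V → V → Set} (c : EdgeCount) →
                    (∀ {u v w} (e : Edge s u v w) → c e ≡ 0 → R u v) →
                    ∀ {u v w} (p : Path s u v w) → count c p ≡ 0 → Linked R (vertices p)
  vertices-linked c ok []                c≡0 = [-]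
  vertices-linked c ok (e ∷ [])          c≡0 = ok e (m+n≡0⇒m≡0 _ c≡0) ∷ [-]
  vertices-linked c ok (e ∷ p@(_ ∷ _))   c≡0 =
    ok e (m+n≡0⇒m≡0 _ c≡0) ∷ vertices-linked c ok p (m+n≡0⇒n≡0 (c e) c≡0)

  y-nondecreasing : ∀ {x y x′ y′ w} → Edge s (x , y) (x′ , y′) w → y ≤ y′
  y-nondecreasing (up _ _)    = n≤1+n _
  y-nondecreasing (right _ _) = ≤-refl
  y-nondecreasing (diag _ _)  = n≤1+n _
  y-nondecreasing (left _ _)  = ≤-refl

  x-nondecreasing : ∀ {x y x′ y′ w} (e : Edge s (x , y) (x′ , y′) w) → isLeftward e ≡ 0 → x ≤ x′
  x-nondecreasing (up _ _)    _ = ≤-refl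
  x-nondecreasing (right _ _) _ = n≤1+n _
  x-nondecreasing (diag _ _)  _ = n≤1+n _

  x-nonincreasing : ∀ {x y x′ y′ w} (e : Edge s (x , y) (x′ , y′) w) → isRightward e ≡ 0 → x′ ≤ x
  x-nonincreasing (up _ _)   _ = ≤-refl
  x-nonincreasing (left _ _) _ = n≤1+n _

  monotone-if-no-leftward : ∀ {u v w} (p : Path s u v w) → count isLeftward p ≡ 0 → Monotone p
  monotone-if-no-leftward p L≡0 =
    inj₁ (Linkedₚ.map⁺ (vertices-linked isLeftward x-nondecreasing p L≡0)) ,
    inj₁ (Linkedₚ.map⁺ (vertices-linked isLeftward (λ e _ → y-nondecreasing e) p L≡0))

  monotone-if-no-rightward : ∀ {u v w} (p : Path s u v w) → count isRightward p ≡ 0 → Monotone p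
  monotone-if-no-rightward p R≡0 =
    inj₂ (Linkedₚ.map⁺ (vertices-linked isRightward x-nonincreasing p R≡0)) ,
    inj₁ (Linkedₚ.map⁺ (vertices-linked isRightward (λ e _ → y-nondecreasing e) p R≡0))

  longest-criterion : ∀ {u v} {a b : ℕ} (slack : ∀ {w} → Path s u v w → ℕ) →
    (∀ {w} (p : Path s u v w) → count isDiagonal p + b + slack p ≤ a + 2 * count isLeftward p) →
    (opt : Path s u v (a ⊖ b)) →
    IsLongest opt × (∀ {w} (p : Path s u v w) → IsLongest p → slack p ≡ 0)
  longest-criterion {a = a} {b} slack bound opt = longest , tight
    where
    longest : IsLongest opt
    longest q = subst (_≤ℤ a ⊖ b) (sym (weight≡ q))
                      (m+q≤p+n⇒m⊖n≤p⊖q _ _ a b (m+n≤o⇒m≤o _ (bound q)))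
    tight : ∀ {w} (p : Path s _ _ w) → IsLongest p → slack p ≡ 0
    tight p p-longest = m+n≤m⇒n≡0 (≤-trans (bound p)
      (m⊖n≤p⊖q⇒m+q≤p+n a b _ _ (subst (a ⊖ b ≤ℤ_) (weight≡ p) (p-longest opt))))


drop-toList : ∀ {n} (s : Seq n) (k : Fin n) →
              drop (toℕ k) (toList s) ≡ lookup s k ∷ drop (suc (toℕ k)) (toList s)
drop-toList (_ ∷ _) Fin.zero    = refl
drop-toList (_ ∷ s) (Fin.suc k) = drop-toList s k

module _ {n} (s : Seq n) (j : ℕ) where

  segment-∷ : ∀ {x} (k : Fin n) → toℕ k ≡ x → x < j → segment s x j ≡ lookup s k ∷ segment s (suc x) j
  segment-∷ k refl k<j = cong₂ take (+-∸-assoc 1 k<j) (drop-toList s k)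

  segment-beyond : ∀ {x} → j ≤ x → segment s x j ≡ []
  segment-beyond {x} j≤x = cong (λ t → take t (drop x (toList s))) (m≤n⇒m∸n≡0 j≤x)

  segmentLIS : V → ℕ
  segmentLIS (x , y) = lis≥ y (segment s x j)

  excess : V → ℕ
  excess (x , _) = x ∸ j

  segmentLIS-beyond : ∀ {x y} → j ≤ x → segmentLIS (x , y) ≡ 0
  segmentLIS-beyond {y = y} j≤x = cong (lis≥ y) (segment-beyond j≤x)

  segmentLIS-∷ : ∀ {x y} (x<n : x < n) → x < j →
                 segmentLIS (x , y) ≡ lis≥ y (lookup s (fromℕ< x<n) ∷ segment s (suc x) j)
  segmentLIS-∷ {y = y} x<n x<j = cong (lis≥ y) (segment-∷ (fromℕ< x<n) (toℕ-fromℕ< x<n) x<j)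

  segmentLIS-suc≤ : ∀ {x y} → x < n → segmentLIS (suc x , y) ≤ segmentLIS (x , y)
  segmentLIS-suc≤ {x} {y} x<n with x <? j
  ... | yes x<j = subst (segmentLIS (suc x , y) ≤_) (sym (segmentLIS-∷ x<n x<j))
                        (lis≥-skip y (lookup s (fromℕ< x<n)) (segment s (suc x) j))
  ... | no  x≮j = ≤-trans (≤-reflexive (segmentLIS-beyond (m≤n⇒m≤1+n (≮⇒≥ x≮j)))) z≤n

  segmentLIS-≤suc : ∀ {x y} → x < n → x < j → segmentLIS (x , y) ≤ suc (segmentLIS (suc x , y))
  segmentLIS-≤suc {x} {y} x<n x<j = subst (_≤ suc (segmentLIS (suc x , y))) (sym (segmentLIS-∷ x<n x<j))
                                          (lis≥-∷≤ y (lookup s (fromℕ< x<n)) (segment s (suc x) j))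

  segmentLIS-take : ∀ (k : Fin n) {v} → lookup s k ≡ just v → toℕ k < j →
                    suc (segmentLIS (suc (toℕ k) , suc v)) ≤ segmentLIS (toℕ k , v)
  segmentLIS-take k {v} k↦v k<j =
    subst (suc (segmentLIS (suc (toℕ k) , suc v)) ≤_)
          (sym (cong (lis≥ v) (trans (segment-∷ k refl k<j) (cong (_∷ segment s (suc (toℕ k)) j) k↦v))))
          (lis≥-take (segment s (suc (toℕ k)) j) ≤-refl)

  potential-step : ∀ {u v w} (e : Edge s u v w) →
                   isDiagonal e + excess u + segmentLIS v ≤ isLeftward e + excess v + segmentLIS u
  potential-step {x , y} (up _ _)      = +-monoʳ-≤ (x ∸ j) (lis≥-antitone (n≤1+n y) (segment s x j))
  potential-step {x , y} (right x<n _) = +-mono-≤ (∸-monoˡ-≤ j (n≤1+n x)) (segmentLIS-suc≤ x<n)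
  potential-step (diag k {v} k↦v) with toℕ k <? j
  ... | yes k<j = begin
    suc ((toℕ k ∸ j) + g′)                      ≡⟨ cong (λ t → suc (t + g′)) (m≤n⇒m∸n≡0 (<⇒≤ k<j)) ⟩
    suc g′                                      ≤⟨ segmentLIS-take k k↦v k<j ⟩
    segmentLIS (toℕ k , v)                      ≤⟨ m≤n+m _ (suc (toℕ k) ∸ j) ⟩
    (suc (toℕ k) ∸ j) + segmentLIS (toℕ k , v)  ∎
    where
    open ≤-Reasoning
    g′ = segmentLIS (suc (toℕ k) , suc v)
  ... | no  k≮j = begin
    suc ((toℕ k ∸ j) + segmentLIS (suc (toℕ k) , suc v)) ≡⟨ cong (λ t → suc ((toℕ k ∸ j) + t)) beyond ⟩
    suc ((toℕ k ∸ j) + 0)                                ≡⟨ cong suc (+-identityʳ _) ⟩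
    suc (toℕ k ∸ j)                                      ≡⟨ +-∸-assoc 1 j≤k ⟨
    suc (toℕ k) ∸ j                                      ≤⟨ m≤m+n _ _ ⟩
    (suc (toℕ k) ∸ j) + segmentLIS (toℕ k , v)           ∎
    where
    open ≤-Reasoning
    j≤k = ≮⇒≥ k≮j
    beyond = segmentLIS-beyond (m≤n⇒m≤1+n j≤k)
  potential-step (left {x} {y} x<n _) with x <? j
  ... | yes x<j = begin
    (suc x ∸ j) + segmentLIS (x , y)       ≡⟨ cong (_+ segmentLIS (x , y)) (m≤n⇒m∸n≡0 x<j) ⟩
    segmentLIS (x , y)                     ≤⟨ segmentLIS-≤suc x<n x<j ⟩
    suc (segmentLIS (suc x , y))           ≤⟨ s≤s (m≤n+m _ _) ⟩
    suc ((x ∸ j) + segmentLIS (suc x , y)) ∎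
    where open ≤-Reasoning
  ... | no  x≮j = begin
    (suc x ∸ j) + segmentLIS (x , y)       ≡⟨ cong₂ _+_ (+-∸-assoc 1 j≤x) (segmentLIS-beyond j≤x) ⟩
    suc (x ∸ j) + 0                        ≤⟨ s≤s (+-monoʳ-≤ (x ∸ j) z≤n) ⟩
    suc ((x ∸ j) + segmentLIS (suc x , y)) ∎
    where
    open ≤-Reasoning
    j≤x = ≮⇒≥ x≮j

  diagonal≤leftward+segmentLIS : ∀ {x y y′ w} (p : Path s (x , y) (j , y′) w) →
                                 count isDiagonal p ≤ count isLeftward p + segmentLIS (x , y)
  diagonal≤leftward+segmentLIS {x} {y} {y′} p = begin
    D                                   ≤⟨ ≤-trans (m≤m+n D (x ∸ j)) (m≤m+n _ _) ⟩
    D + (x ∸ j) + segmentLIS (j , y′)   ≤⟨ telescope isDiagonal isLeftward excess segmentLIS potential-step p ⟩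
    L + (j ∸ j) + segmentLIS (x , y)    ≡⟨ cong (λ t → L + t + segmentLIS (x , y)) (n∸n≡0 j) ⟩
    L + 0 + segmentLIS (x , y)          ≡⟨ cong (_+ segmentLIS (x , y)) (+-identityʳ L) ⟩
    L + segmentLIS (x , y)              ∎
    where
    open ≤-Reasoning
    D = count isDiagonal p
    L = count isLeftward p

module _ {n} {s : Seq n} where

  climb : ∀ {x y y′ t w} → x ≤ n → y ≤‴ y′ → y′ ≤ m∣ s → Path s (x , y′) t w → Path s (x , y) t w
  climb x≤n ≤‴-refl          _    p = p
  climb {w = w} x≤n (≤‴-step y<y′) y′≤m p =
    subst (Path s _ _) (ℤP.+-identityˡ w)
          (up x≤n (≤-trans (≤‴⇒≤ y<y′) y′≤m) ∷ climb x≤n y<y′ y′≤m p)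

  retreat : ∀ k {x y} → k + x ≤ n → y ≤ m∣ s → Path s (k + x , y) (x , y) (0 ⊖ 2 * k)
  retreat zero    _     _   = []
  retreat (suc k) k+x<n y≤m =
    subst (Path s _ _) (trans (ℤP.distribʳ-⊖-+-neg 1 0 (2 * k)) (cong (0 ⊖_) (sym (*-suc 2 k))))
          (left k+x<n y≤m ∷ retreat k (<⇒≤ k+x<n) y≤m)

  diagAt : ∀ {x v} (k : Fin n) → toℕ k ≡ x → lookup s k ≡ just v → Edge s (x , v) (suc x , suc v) (+ 1)
  diagAt k refl = diag k

  entry<|s*| : IsSubpermutation s → ∀ {k v} → lookup s k ≡ just v → v < m∣ s
  entry<|s*| (_ , s*↭) {k} k↦v =
    ∈-upTo⁻ (∈-resp-↭ s*↭ (∈-catMaybes⁺ (∈-toList⁺ (subst (_∈ᵥ s) k↦v (∈-lookup k s)))))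

module _ {n} {s : Seq n} (sp : IsSubpermutation s) {j} (j≤n : j ≤ n) where

  ToTop : V → ℕ → Set
  ToTop u t = Path s u (j , m∣ s) (+ t)

  optimalPath : ∀ {x y} → x ≤‴ j → y ≤ m∣ s → ToTop (x , y) (segmentLIS s j (x , y))
  optimalPath {y = y} ≤‴-refl y≤m =
    subst (ToTop (j , y)) (sym (segmentLIS-beyond s j ≤-refl)) (climb j≤n (≤⇒≤‴ y≤m) ≤-refl [])
  optimalPath {x} {y} (≤‴-step x<j) y≤m =
    subst (ToTop (x , y)) (sym (segmentLIS-∷ s j x<n (≤‴⇒≤ x<j))) (via (lookup s k) refl)
    where
    x<n = <-≤-trans (≤‴⇒≤ x<j) j≤n
    k = fromℕ< x<n
    via : (a : Maybe ℕ) → lookup s k ≡ a → ToTop (x , y) (lis≥ y (a ∷ segment s (suc x) j))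
    via nothing _ = right x<n y≤m ∷ optimalPath x<j y≤m
    via (just v) k↦v with y ≤? v
    ... | no _ = right x<n y≤m ∷ optimalPath x<j y≤m
    ... | yes y≤v with ⊔-sel (suc (segmentLIS s j (suc x , suc v))) (segmentLIS s j (suc x , y))
    ...   | inj₁ ⊔≡take =
      subst (ToTop (x , y)) (sym ⊔≡take)
            (climb (<⇒≤ x<n) (≤⇒≤‴ y≤v) (<⇒≤ v<m) (diagAt k (toℕ-fromℕ< x<n) k↦v ∷ optimalPath x<j v<m))
      where v<m = entry<|s*| sp k↦v
    ...   | inj₂ ⊔≡skip =
      subst (ToTop (x , y)) (sym ⊔≡skip) (right x<n y≤m ∷ optimalPath x<j y≤m)

  forward-longest : ∀ {i} → i ≤ j →
    M≡ s i j (+ segmentLIS s j (i , 0)) ×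
    (∀ {w} (p : Path s (i , 0) (j , m∣ s) w) → IsLongest p → count isLeftward p ≡ 0)
  forward-longest {i} i≤j =
    map₁ (opt ,_) (longest-criterion {a = segmentLIS s j (i , 0)} {b = 0} (count isLeftward) bound opt)
    where
    opt = optimalPath (≤⇒≤‴ i≤j) z≤n
    bound : ∀ {w} (p : Path s (i , 0) (j , m∣ s) w) →
            count isDiagonal p + 0 + count isLeftward p ≤ segmentLIS s j (i , 0) + 2 * count isLeftward p
    bound p = begin
      D + 0 + L   ≡⟨ cong (_+ L) (+-identityʳ D) ⟩
      D + L       ≤⟨ +-monoˡ-≤ L (diagonal≤leftward+segmentLIS s j p) ⟩
      L + g + L   ≡⟨ regroup L g ⟩
      g + 2 * L   ∎
      where
      open ≤-Reasoning
      D = count isDiagonal p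
      L = count isLeftward p
      g = segmentLIS s j (i , 0)
      regroup : ∀ L g → L + g + L ≡ g + 2 * L
      regroup = solve-∀

backward-longest : ∀ {n} {s : Seq n} {i j} → j ≤ i → i ≤ n →
  M≡ s i j (0 ⊖ 2 * (i ∸ j)) ×
  (∀ {w} (p : Path s (i , 0) (j , m∣ s) w) → IsLongest p → count isRightward p ≡ 0)
backward-longest {n} {s} {i} {j} j≤i i≤n =
  map₁ (opt ,_) (longest-criterion {a = 0} {b = 2 * (i ∸ j)} (count isRightward) bound opt)
  where
  opt = climb i≤n (≤⇒≤‴ z≤n) ≤-refl
          (subst (λ x → Path s (x , m∣ s) (j , m∣ s) (0 ⊖ 2 * (i ∸ j))) (m∸n+n≡m j≤i)
                 (retreat (i ∸ j) (subst (_≤ n) (sym (m∸n+n≡m j≤i)) i≤n) ≤-refl))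
  bound : ∀ {w} (p : Path s (i , 0) (j , m∣ s) w) →
          count isDiagonal p + 2 * (i ∸ j) + count isRightward p ≤ 2 * count isLeftward p
  bound p = begin
    D + 2 * k + R   ≤⟨ +-monoˡ-≤ R (+-monoˡ-≤ (2 * k) (diagonal≤rightward p)) ⟩
    R + 2 * k + R   ≡⟨ regroup R k ⟩
    2 * (R + k)     ≡⟨ cong (2 *_) (leftward≡rightward+∸ j≤i p) ⟨
    2 * L           ∎
    where
    open ≤-Reasoning
    k = i ∸ j
    D = count isDiagonal p
    L = count isLeftward p
    R = count isRightward p
    regroup : ∀ R k → R + 2 * k + R ≡ 2 * (R + k)
    regroup = solve-∀

lemma5p7 : ∀ (n : ℕ) (s : Seq n) → IsSubpermutation s →
    ∀ (i j : ℕ) → i ≤ n → j ≤ n →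
    (i < j → M≡ s i j (+ LIS (segment s i j))) ×
    (j ≤ i → M≡ s i j (- (+ (2 * (i ∸ j))))) ×
    (∀ {w} (p : Path s (i , 0) (j , m∣ s) w) → IsLongest p → Monotone p)
lemma5p7 n s sp i j i≤n j≤n = forward , backward , monotone
  where
  forward : i < j → M≡ s i j (+ LIS (segment s i j))
  forward i<j = subst (M≡ s i j ∘ +_) (sym (LIS≡lis≥0 (segment s i j)))
                      (proj₁ (forward-longest sp j≤n (<⇒≤ i<j)))
  backward : j ≤ i → M≡ s i j (- (+ (2 * (i ∸ j))))
  backward j≤i = subst (M≡ s i j) (ℤP.⊖-≤ z≤n) (proj₁ (backward-longest j≤i i≤n))
  monotone : ∀ {w} (p : Path s (i , 0) (j , m∣ s) w) → IsLongest p → Monotone p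
  monotone p p-longest with i ≤? j
  ... | yes i≤j = monotone-if-no-leftward p (proj₂ (forward-longest sp j≤n i≤j) p p-longest)
  ... | no  i≰j = monotone-if-no-rightward p (proj₂ (backward-longest (≰⇒≥ i≰j) i≤n) p p-longest)
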